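{- $\mathit{Leaf}(\mathbb{T}^S_{!(T1)}(G))=\Pi_{\mathit{mcp}}(G)$.
   Context: Let $G=(V,E)$ be a finite undirected graph. A clique is a nonempty set of pairwise adjacent vertices; it is maximal if not properly contained in another clique. A clique-partition of $G$ is a partition of $V$ into cliques; it is maximal if it does not contain two different cliques $C,C'$ with $C\cup C'$ a clique. Fix an enumeration $\overline{C}_1,\ldots,\overline{C}_m$ of all maximal cliques of $G$. For $v\in V$ let $\mathit{cliques}(v):=\{i\in[m]\mid v\in\overline{C}_i\}$, $d(v):=|\mathit{cliques}(v)|$, and for nonempty $C\subseteq V$ let $\mathit{cliques}(C):=\bigcap_{v\in C}\mathit{cliques}(v)$. Let $\mathit{Rgd}:=\{k\in[m]\mid \exists v\in V,\ \mathit{cliques}(v)=\{k\}\}$. Fix an enumeration $S=[v_1,\ldots,v_s]$ of all vertices $v$ with $d(v)>1$. A configuration is a list $[C_1,\ldots,C_m]$ where each $C_i$ is empty or a clique, $C_i\subseteq\overline{C}_i$, and $\bigcup_i C_i=V$; $\mathit{repr}([C_1,\ldots,C_m]):=\{C_i\mid C_i\neq\emptyset\}$. $\Pi_{\mathit{mcp}}(G)$ is the set of configurations whose $\mathit{repr}$ is a maximal clique-partition. Write $[C_1,\ldots,C_m]\to_{(v,i)}[C'_1,\ldots,C'_m]$ if $v\in C_i$, $C'_i=C_i$ and $C'_j=C_j\setminus\{v\}$ for $j\neq i$. The search tree $\mathbb{T}^S(G)$ has root $[\overline{C}_1,\ldots,\overline{C}_m]$ at depth $0$; a node at depth $k<s$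 carrying $\mathit{cfg}$ has, for each $i\in\mathit{cliques}(v_{k+1})$, a child at depth $k+1$ carrying $\mathit{cfg}'$ with $\mathit{cfg}\to_{(v_{k+1},i)}\mathit{cfg}'$. For a node reached by $\mathit{cfg}_0\to_{(v_1,i_1)}\cdots\to_{(v_\ell,i_\ell)}\mathit{cfg}$ set $\delta(\mathit{cfg}):=[i_1,\ldots,i_\ell]$. A node $\mathit{cfg}=[C_1,\ldots,C_m]$ with $\delta(\mathit{cfg})=[i_1,\ldots,i_\ell]$ is a $T1$-node if either (a) $\mathit{cliques}(C_a)\cap\mathit{Rgd}\neq\emptyset$ for some $a\in\{i_1,\ldots,i_\ell\}\setminus\mathit{Rgd}$, or (b) $\mathit{cliques}(C_a)\cap\mathit{cliques}(C_b)\neq\emptyset$ for distinct $a,b\in\{i_1,\ldots,i_\ell\}$. $\mathbb{T}^S_{!(T1)}(G)$ is obtained from $\mathbb{T}^S(G)$ by removing every subtree whose root is a $T1$-node; $\mathit{Leaf}(\mathbb{T}^S_{!(T1)}(G))$ is the set of configurations at depth $s$ in this pruned tree.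
   Formalization: In $\Pi_{\mathit{mcp}}(G)$, nonempty $C_i$ and $C_j$ at distinct indices i ≠ j must be disjoint with $C_i\cup C_j$ not a clique, so repr is taken as an indexed family of blocks rather than a set. Apart from conventions, each condition added here is assumed in the paper as well or is needed for the statement above to hold. -}

module Defs where

open import Data.Nat using (ℕ; _<_)
open import Data.Fin using (Fin)
open import Data.Fin.Subset using (Subset; _∈_; _∉_; _⊆_; _∪_; _─_; ⁅_⁆; ⊥; ∣_∣; Nonempty)
open import Data.Vec using (Vec; lookup; tabulate)
open import Data.Bool using (Bool; true)
open import Data.List using (List; []; _∷_; _++_)
open import Data.List.Membership.Propositional using () renaming (_∈_ to _∈L_)
open import Data.List.Relation.Unary.Unique.Propositional using (Unique)
open import Data.Product using (Σ; ∃; _×_; _,_)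
open import Data.Sum using (_⊎_)
open import Relation.Binary.PropositionalEquality using (_≡_; _≢_)
open import Relation.Nullary using (¬_)
open import Function.Bundles using (_⇔_)

record Graph (n : ℕ) : Set where
  field
    adj : Fin n → Fin n → Bool
    sym : ∀ u v → adj u v ≡ adj v u

open Graph public

IsClique : ∀ {n} → Graph n → Subset n → Set
IsClique G C = Nonempty C × (∀ u v → u ∈ C → v ∈ C → u ≢ v → adj G u v ≡ true)

IsMaxClique : ∀ {n} → Graph n → Subset n → Set
IsMaxClique G C = IsClique G C × (∀ D → IsClique G D → C ⊆ D → D ≡ C)

IsMaxCliqueEnum : ∀ {n m} → Graph n → Vec (Subset n) m → Set
IsMaxCliqueEnum {n} {m} G Cbar =
    (∀ i → IsMaxClique G (lookup Cbar i))
  × (∀ i j → lookup Cbar i ≡ lookup Cbar j → i ≡ j)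
  × (∀ C → IsMaxClique G C → ∃ λ i → lookup Cbar i ≡ C)

module Setup {n m : ℕ} (G : Graph n) (Cbar : Vec (Subset n) m) where

  Cfg : Set
  Cfg = Vec (Subset n) m

  cliques : Fin n → Subset m
  cliques v = tabulate (λ i → lookup (lookup Cbar i) v)

  d : Fin n → ℕ
  d v = ∣ cliques v ∣

  InCliquesOf : Subset n → Fin m → Set
  InCliquesOf C k = ∀ v → v ∈ C → k ∈ cliques v

  Rgd : Fin m → Set
  Rgd k = ∃ λ v → cliques v ≡ ⁅ k ⁆

  IsSEnum : List (Fin n) → Set
  IsSEnum S = Unique S × (∀ v → (v ∈L S) ⇔ (1 < d v))

  IsConfig : Cfg → Set
  IsConfig cfg =
      (∀ i → (lookup cfg i ≡ ⊥ ⊎ IsClique G (lookup cfg i)) × lookup cfg i ⊆ lookup Cbar i)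
    × (∀ v → ∃ λ i → v ∈ lookup cfg i)

  ReprIsMaxCliquePartition : Cfg → Set
  ReprIsMaxCliquePartition cfg =
      (∀ i → Nonempty (lookup cfg i) → IsClique G (lookup cfg i))
    × (∀ i j → i ≢ j → Nonempty (lookup cfg i) → Nonempty (lookup cfg j) →
         ∀ v → v ∈ lookup cfg i → v ∉ lookup cfg j)
    × (∀ v → ∃ λ i → Nonempty (lookup cfg i) × v ∈ lookup cfg i)
    × (∀ i j → i ≢ j → Nonempty (lookup cfg i) → Nonempty (lookup cfg j) →
         ¬ IsClique G (lookup cfg i ∪ lookup cfg j))

  Πmcp : Cfg → Set
  Πmcp cfg = IsConfig cfg × ReprIsMaxCliquePartition cfg

  root : Cfg
  root = Cbar

  Step : Cfg → Fin n → Fin m → Cfg → Set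
  Step cfg v i cfg' =
      v ∈ lookup cfg i
    × lookup cfg' i ≡ lookup cfg i
    × (∀ j → j ≢ i → lookup cfg' j ≡ lookup cfg j ─ ⁅ v ⁆)

  T1 : List (Fin m) → Cfg → Set
  T1 δ cfg =
      (∃ λ a → a ∈L δ × ¬ Rgd a × ∃ λ k → InCliquesOf (lookup cfg a) k × Rgd k)
    ⊎ (∃ λ a → ∃ λ b → a ∈L δ × b ∈L δ × a ≢ b ×
         ∃ λ k → InCliquesOf (lookup cfg a) k × InCliquesOf (lookup cfg b) k)

  -- PrunedPath δ cfg vs cfgF : from the (surviving) node with history δ carrying cfg,
  -- processing the remaining vertices vs of S, one reaches the depth-s node carrying
  -- cfgF with every node on the way not a T1-node.
  data PrunedPath : List (Fin m) → Cfg → List (Fin n) → Cfg → Set where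
    done : ∀ {δ cfg} → PrunedPath δ cfg [] cfg
    step : ∀ {δ cfg cfg' cfgF v vs} (i : Fin m) →
           i ∈ cliques v → Step cfg v i cfg' →
           ¬ T1 (δ ++ (i ∷ [])) cfg' →
           PrunedPath (δ ++ (i ∷ [])) cfg' vs cfgF →
           PrunedPath δ cfg (v ∷ vs) cfgF

  Leaf : List (Fin n) → Cfg → Set
  Leaf S cfg = ¬ T1 [] root × PrunedPath [] root S cfg

-- Along a root-to-leaf path every vertex of S is assigned to one of its maximal cliques and
-- removed from the others, while every other vertex lies in a single maximal clique and stays
-- there; so a leaf is a clique-partition whose i-th block lies in C̄ i. A merge
-- of two blocks would put both inside one maximal clique C̄ k. If both blocks received a vertex
-- of S this is condition (b) of T1; if one did not, all its vertices are rigid, so it is the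
-- block of C̄ k itself and the other one is caught by condition (a); two blocks without vertices
-- of S sit in different maximal cliques. Conversely, a maximal clique-partition is reached by
-- assigning each vertex of S to its own block, in the order of S: the nodes on the way
-- dominate the partition blockwise, so a T1-node there would exhibit a mergeable pair.
module Submission where

open import Defs hiding (sym)
open import Data.Nat using (ℕ; zero; suc; _≤_; _<_; _+_)
open import Data.Nat.Properties
  using (≤-trans; ≤-antisym; +-identityʳ; m≤n+m; +-suc; +-monoˡ-≤; <-irrefl; ≮⇒≥; module ≤-Reasoning)
open import Data.Fin using (Fin; zero; suc; _≟_)
open import Data.Fin.Subset using (Subset; _∈_; _∉_; _⊆_; _∪_; _∩_; _─_; _-_; ⁅_⁆; ⊥; ⊤; ∣_∣; Nonempty)
open import Data.Fin.Subset.Properties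
  using (_∈?_; ⊆-refl; ⊆-antisym; x∈⁅x⁆; x∈⁅y⁆⇒x≡y; x∉⁅y⁆⇒x≢y; ∣⁅x⁆∣≡1; x∈p⇒∣p-x∣<∣p∣; x∈p∧x≢y⇒x∈p-y;
         p⊆q⇒∣p∣≤∣q∣; p⊂q⇒∣p∣<∣q∣; ∣p∣≡n⇒p≡⊤; ∣p∣≤n; ∈⊤; x∈p∪q⁻; x∈p∪q⁺; p⊆p∪q; q⊆p∪q; p─q⊆p;
         x∈p∩q⁺; x∈p∩q⁻; nonempty?; Empty-unique; drop-there)
open import Data.Fin.Properties using (any?; all?)
open import Data.Vec using (Vec; _∷_; lookup; tabulate; here; there)
open import Data.Vec.Properties
  using (lookup∘tabulate; tabulate∘lookup; tabulate-cong; lookup⇒[]=; []=⇒lookup)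
open import Data.Bool using (true; false)
import Data.Bool as Bool
open import Data.List using (List; []; _∷_; _++_)
open import Data.List.Properties using (++-identityʳ; ++-assoc)
open import Data.List.Membership.Propositional using () renaming (_∈_ to _∈L_)
open import Data.List.Membership.Propositional.Properties using (∈-++⁻; ∈-++⁺ˡ; ∈-++⁺ʳ)
open import Data.List.Relation.Unary.Any using (here; there)
open import Data.List.Relation.Unary.Unique.Propositional using (Unique; _∷_)
open import Data.List.Relation.Unary.Unique.Propositional.Properties using (Unique[x∷xs]⇒x∉xs)
import Data.List.Relation.Unary.Any as Any
open import Data.Product using (∃; _×_; _,_; proj₁; proj₂)
import Data.Sum as Sum
open import Data.Sum using (_⊎_; inj₁; inj₂; [_,_]; [_,_]′)
open import Data.Empty using (⊥-elim)
open import Relation.Binary.PropositionalEquality using (_≡_; _≢_; refl; sym; trans; cong; subst)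
open import Relation.Nullary using (¬_; Dec; yes; no; contradiction)
open import Relation.Nullary.Decidable using (¬?; _×-dec_; _→-dec_)
open import Function using (id; _∘_)
open import Function.Bundles using (_⇔_; mk⇔; Equivalence)

open Equivalence using (to; from)

x∈p─q⇒x∉q : ∀ {k} {p q : Subset k} {x} → x ∈ p ─ q → x ∉ q
x∈p─q⇒x∉q {p = _ ∷ p} {false ∷ q} {zero} here = λ ()
x∈p─q⇒x∉q {p = _ ∷ p} {true ∷ q}  {zero} ()
x∈p─q⇒x∉q {p = _ ∷ p} {_ ∷ q} {suc x} (there x∈) = x∈p─q⇒x∉q x∈ ∘ drop-there

x∈p-y⇒x≢y : ∀ {k} {p : Subset k} {x y} → x ∈ p - y → x ≢ y
x∈p-y⇒x≢y = x∉⁅y⁆⇒x≢y ∘ x∈p─q⇒x∉q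

∣p∣≤1⇒x∈p⇒y∈p⇒x≡y : ∀ {k} {p : Subset k} {x y} → ∣ p ∣ ≤ 1 → x ∈ p → y ∈ p → x ≡ y
∣p∣≤1⇒x∈p⇒y∈p⇒x≡y {p = p} {x} {y} ∣p∣≤1 x∈p y∈p with x ≟ y
... | yes x≡y = x≡y
... | no x≢y = contradiction 1<1 (<-irrefl refl)
  where
  open ≤-Reasoning
  ⁅y⁆⊆p-x : ⁅ y ⁆ ⊆ p - x
  ⁅y⁆⊆p-x z∈⁅y⁆ rewrite x∈⁅y⁆⇒x≡y y z∈⁅y⁆ = x∈p∧x≢y⇒x∈p-y y∈p (x≢y ∘ sym)
  1<1 : 1 < 1
  1<1 = begin-strict
    1             ≡⟨ sym (∣⁅x⁆∣≡1 y) ⟩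
    ∣ ⁅ y ⁆ ∣     ≤⟨ p⊆q⇒∣p∣≤∣q∣ ⁅y⁆⊆p-x ⟩
    ∣ p - x ∣     <⟨ x∈p⇒∣p-x∣<∣p∣ x∈p ⟩
    ∣ p ∣         ≤⟨ ∣p∣≤1 ⟩
    1             ∎

Unique[xs++y∷ys]⇒y∉xs : ∀ {A : Set} xs {y : A} {ys} → Unique (xs ++ y ∷ ys) → ¬ y ∈L xs
Unique[xs++y∷ys]⇒y∉xs (x ∷ xs) uniq (here refl) = Unique[x∷xs]⇒x∉xs uniq (∈-++⁺ʳ xs (here refl))
Unique[xs++y∷ys]⇒y∉xs (x ∷ xs) (_ ∷ uniq) (there y∈xs) = Unique[xs++y∷ys]⇒y∉xs xs uniq y∈xs

_∈L?_ : ∀ {k} (x : Fin k) xs → Dec (x ∈L xs)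
x ∈L? xs = Any.any? (x ≟_) xs

lookup-⊆-antisym : ∀ {k l} {u v : Vec (Subset k) l} →
  (∀ i → lookup u i ⊆ lookup v i) → (∀ i → lookup v i ⊆ lookup u i) → u ≡ v
lookup-⊆-antisym {u = u} {v} u⊆v v⊆u =
  trans (sym (tabulate∘lookup u))
        (trans (tabulate-cong (λ i → ⊆-antisym (u⊆v i) (v⊆u i))) (tabulate∘lookup v))

module Cliques {n : ℕ} (G : Graph n) where

  clique-⊆ : ∀ {D E} → Nonempty D → D ⊆ E → IsClique G E → IsClique G D
  clique-⊆ D≠∅ D⊆E (_ , adjE) = D≠∅ , λ u v u∈D v∈D → adjE u v (D⊆E u∈D) (D⊆E v∈D)

  ⁅⁆-clique : ∀ v → IsClique G ⁅ v ⁆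
  ⁅⁆-clique v = (v , x∈⁅x⁆ v) , λ x y x∈ y∈ x≢y →
    contradiction (trans (x∈⁅y⁆⇒x≡y v x∈) (sym (x∈⁅y⁆⇒x≡y v y∈))) x≢y

  Extends : Subset n → Fin n → Set
  Extends D u = u ∉ D × (∀ w → w ∈ D → adj G u w ≡ true)

  extends? : ∀ D u → Dec (Extends D u)
  extends? D u = ¬? (u ∈? D) ×-dec all? (λ w → (w ∈? D) →-dec (adj G u w Bool.≟ true))

  ∪⁅⁆-clique : ∀ {D u} → IsClique G D → Extends D u → IsClique G (D ∪ ⁅ u ⁆)
  ∪⁅⁆-clique {D} {u} ((w , w∈D) , adjD) (_ , adjU) = (w , p⊆p∪q ⁅ u ⁆ w∈D) , adj∪
    where
    adj∪ : ∀ x y → x ∈ D ∪ ⁅ u ⁆ → y ∈ D ∪ ⁅ u ⁆ → x ≢ y → adj G x y ≡ true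
    adj∪ x y x∈ y∈ x≢y with x∈p∪q⁻ D ⁅ u ⁆ x∈ | x∈p∪q⁻ D ⁅ u ⁆ y∈
    ... | inj₁ x∈D | inj₁ y∈D = adjD x y x∈D y∈D x≢y
    ... | inj₁ x∈D | inj₂ y≡u rewrite x∈⁅y⁆⇒x≡y u y≡u = trans (Graph.sym G x u) (adjU x x∈D)
    ... | inj₂ x≡u | inj₁ y∈D rewrite x∈⁅y⁆⇒x≡y u x≡u = adjU y y∈D
    ... | inj₂ x≡u | inj₂ y≡u = contradiction (trans (x∈⁅y⁆⇒x≡y u x≡u) (sym (x∈⁅y⁆⇒x≡y u y≡u))) x≢y

  unextendable⇒maximal : ∀ {D} → IsClique G D → (∀ u → ¬ Extends D u) → IsMaxClique G D
  unextendable⇒maximal {D} cD ¬ext = cD , λ E cE D⊆E → ⊆-antisym (E⊆D cE D⊆E) D⊆E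
    where
    E⊆D : ∀ {E} → IsClique G E → D ⊆ E → E ⊆ D
    E⊆D {E} (_ , adjE) D⊆E {x} x∈E with x ∈? D
    ... | yes x∈D = x∈D
    ... | no x∉D = ⊥-elim (¬ext x (x∉D , λ w w∈D →
            adjE x w x∈E (D⊆E w∈D) (λ x≡w → x∉D (subst (_∈ D) (sym x≡w) w∈D))))

  grow-clique : ∀ k {D} → n ≤ ∣ D ∣ + k → IsClique G D → ∃ λ M → IsMaxClique G M × D ⊆ M
  grow-clique k {D} bound cD with any? (extends? D)
  ... | no ¬ext = D , unextendable⇒maximal cD (λ u ext → ¬ext (u , ext)) , ⊆-refl
  grow-clique zero {D} bound cD | yes (u , u∉D , _) =
    contradiction (subst (u ∈_) (sym D≡⊤) ∈⊤) u∉D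
    where
    D≡⊤ : D ≡ ⊤
    D≡⊤ = ∣p∣≡n⇒p≡⊤ (≤-antisym (∣p∣≤n D) (subst (n ≤_) (+-identityʳ ∣ D ∣) bound))
  grow-clique (suc k) {D} bound cD | yes (u , ext@(u∉D , _))
    with grow-clique k bound′ (∪⁅⁆-clique cD ext)
    where
    D⊂D∪u : ∣ D ∣ < ∣ D ∪ ⁅ u ⁆ ∣
    D⊂D∪u = p⊂q⇒∣p∣<∣q∣ (p⊆p∪q ⁅ u ⁆ , u , q⊆p∪q D ⁅ u ⁆ (x∈⁅x⁆ u) , u∉D)
    bound′ : n ≤ ∣ D ∪ ⁅ u ⁆ ∣ + k
    bound′ = ≤-trans bound (subst (_≤ ∣ D ∪ ⁅ u ⁆ ∣ + k) (sym (+-suc ∣ D ∣ k)) (+-monoˡ-≤ k D⊂D∪u))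
  ... | M , maxM , D∪u⊆M = M , maxM , λ x∈D → D∪u⊆M (p⊆p∪q ⁅ u ⁆ x∈D)

  ⊆-maxClique : ∀ {D} → IsClique G D → ∃ λ M → IsMaxClique G M × D ⊆ M
  ⊆-maxClique {D} = grow-clique n (m≤n+m n ∣ D ∣)

module Configurations {n m : ℕ} (G : Graph n) (Cbar : Vec (Subset n) m) where
  open Setup G Cbar

  Confines : Cfg → Fin n → Fin m → Cfg → Set
  Confines cfg v i cfg′ = ∀ j w → w ∈ lookup cfg′ j ⇔ (w ∈ lookup cfg j × (j ≡ i ⊎ w ≢ v))

  other-block : ∀ {i j : Fin m} {w v : Fin n} → j ≢ i → j ≡ i ⊎ w ≢ v → w ≢ v
  other-block j≢i = [ (λ j≡i → contradiction j≡i j≢i) , id ]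

  step⇒confines : ∀ {cfg v i cfg′} → Step cfg v i cfg′ → Confines cfg v i cfg′
  step⇒confines {cfg} {v} {i} {cfg′} (_ , same-i , minus-v) j w with j ≟ i
  ... | yes refl = mk⇔ (λ w∈ → subst (w ∈_) same-i w∈ , inj₁ refl)
                       (λ (w∈ , _) → subst (w ∈_) (sym same-i) w∈)
  ... | no j≢i = mk⇔ (λ w∈ → let w∈′ = subst (w ∈_) (minus-v j j≢i) w∈ in
                                p─q⊆p (lookup cfg j) ⁅ v ⁆ w∈′ , inj₂ (x∈p-y⇒x≢y w∈′))
                     (λ (w∈ , j≡i⊎w≢v) → subst (w ∈_) (sym (minus-v j j≢i))
                        (x∈p∧x≢y⇒x∈p-y w∈ (other-block j≢i j≡i⊎w≢v)))

  confines⇒step : ∀ {cfg v i cfg′} → v ∈ lookup cfg i → Confines cfg v i cfg′ → Step cfg v i cfg′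
  confines⇒step {cfg} {v} {i} {cfg′} v∈ conf = v∈ , same-i , minus-v
    where
    same-i : lookup cfg′ i ≡ lookup cfg i
    same-i = ⊆-antisym (proj₁ ∘ to (conf i _)) (λ w∈ → from (conf i _) (w∈ , inj₁ refl))
    minus-v : ∀ j → j ≢ i → lookup cfg′ j ≡ lookup cfg j ─ ⁅ v ⁆
    minus-v j j≢i = ⊆-antisym
      (λ w∈ → let (w∈′ , j≡i⊎w≢v) = to (conf j _) w∈ in
               x∈p∧x≢y⇒x∈p-y w∈′ (other-block j≢i j≡i⊎w≢v))
      (λ w∈ → from (conf j _) (p─q⊆p (lookup cfg j) ⁅ v ⁆ w∈ , inj₂ (x∈p-y⇒x≢y w∈)))

  ¬T1-[] : ∀ cfg → ¬ T1 [] cfg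
  ¬T1-[] cfg (inj₁ (_ , () , _))
  ¬T1-[] cfg (inj₂ (_ , _ , () , _))

module Enumeration {n m : ℕ} (G : Graph n) (Cbar : Vec (Subset n) m)
                   (enum : IsMaxCliqueEnum G Cbar) where
  open Setup G Cbar
  open Cliques G
  open Configurations G Cbar

  C̄ : Fin m → Subset n
  C̄ = lookup Cbar

  C̄-clique : ∀ i → IsClique G (C̄ i)
  C̄-clique i = proj₁ (proj₁ enum i)

  ∈cliques⁺ : ∀ {v k} → v ∈ C̄ k → k ∈ cliques v
  ∈cliques⁺ {v} {k} v∈ = lookup⇒[]= k (cliques v) (trans (lookup∘tabulate _ k) ([]=⇒lookup v∈))

  ∈cliques⁻ : ∀ {v k} → k ∈ cliques v → v ∈ C̄ k
  ∈cliques⁻ {v} {k} k∈ = lookup⇒[]= v (C̄ k) (trans (sym (lookup∘tabulate _ k)) ([]=⇒lookup k∈))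

  InCliquesOf⇒⊆ : ∀ {D k} → InCliquesOf D k → D ⊆ C̄ k
  InCliquesOf⇒⊆ inc v∈ = ∈cliques⁻ (inc _ v∈)

  ⊆⇒InCliquesOf : ∀ {D k} → D ⊆ C̄ k → InCliquesOf D k
  ⊆⇒InCliquesOf D⊆ v v∈ = ∈cliques⁺ (D⊆ v∈)

  clique⊆C̄ : ∀ {D} → IsClique G D → ∃ λ k → D ⊆ C̄ k
  clique⊆C̄ cD with ⊆-maxClique cD
  ... | M , maxM , D⊆M with proj₂ (proj₂ enum) M maxM
  ... | k , C̄k≡M = k , λ v∈ → subst (_ ∈_) (sym C̄k≡M) (D⊆M v∈)

  ∪-clique : ∀ {D E k} → Nonempty D → D ⊆ C̄ k → E ⊆ C̄ k → IsClique G (D ∪ E)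
  ∪-clique {D} {E} (v , v∈D) D⊆ E⊆ =
    clique-⊆ (v , p⊆p∪q E v∈D) (λ w∈ → [ D⊆ , E⊆ ] (x∈p∪q⁻ D E w∈)) (C̄-clique _)

  d≤1⇒same-clique : ∀ {v i j} → d v ≤ 1 → v ∈ C̄ i → v ∈ C̄ j → i ≡ j
  d≤1⇒same-clique dv≤1 v∈i v∈j = ∣p∣≤1⇒x∈p⇒y∈p⇒x≡y dv≤1 (∈cliques⁺ v∈i) (∈cliques⁺ v∈j)

  d≤1⇒cliques≡⁅⁆ : ∀ {v k} → d v ≤ 1 → v ∈ C̄ k → cliques v ≡ ⁅ k ⁆
  d≤1⇒cliques≡⁅⁆ {v} {k} dv≤1 v∈k = ⊆-antisym
    (λ j∈ → subst (_∈ ⁅ k ⁆) (d≤1⇒same-clique dv≤1 v∈k (∈cliques⁻ j∈)) (x∈⁅x⁆ k))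
    (λ j∈ → subst (_∈ cliques v) (sym (x∈⁅y⁆⇒x≡y k j∈)) (∈cliques⁺ v∈k))

  cliques≡⁅⁆⇒∈ : ∀ {v k} → cliques v ≡ ⁅ k ⁆ → v ∈ C̄ k
  cliques≡⁅⁆⇒∈ {k = k} eq = ∈cliques⁻ (subst (k ∈_) (sym eq) (x∈⁅x⁆ k))

  cliques≡⁅⁆⇒≡ : ∀ {v k j} → cliques v ≡ ⁅ k ⁆ → v ∈ C̄ j → j ≡ k
  cliques≡⁅⁆⇒≡ {k = k} eq v∈j = x∈⁅y⁆⇒x≡y k (subst (_ ∈_) eq (∈cliques⁺ v∈j))

  module _ {S : List (Fin n)} (senum : IsSEnum S) where

    ∉S⇒d≤1 : ∀ {v} → ¬ v ∈L S → d v ≤ 1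
    ∉S⇒d≤1 {v} v∉S = ≮⇒≥ (v∉S ∘ from (proj₂ senum v))

    cliques≡⁅⁆⇒∉S : ∀ {v k} → cliques v ≡ ⁅ k ⁆ → ¬ v ∈L S
    cliques≡⁅⁆⇒∉S {v} {k} eq v∈S =
      <-irrefl refl (subst (1 <_) (trans (cong ∣_∣ eq) (∣⁅x⁆∣≡1 k)) (to (proj₂ senum v) v∈S))

    -- Along a path of the pruned tree, P lists the vertices of S assigned so far.
    record Invariant (δ : List (Fin m)) (c : Cfg) (P : List (Fin n)) : Set where
      field
        ⊆C̄ : ∀ i → lookup c i ⊆ C̄ i
        unassigned : ∀ {i w} → ¬ w ∈L P → w ∈ C̄ i → w ∈ lookup c i
        assigned : ∀ {w} → w ∈L P →
          ∃ λ i → i ∈L δ × w ∈ lookup c i × (∀ {j} → w ∈ lookup c j → j ≡ i)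

    invariant-root : Invariant [] root []
    invariant-root = record { ⊆C̄ = λ _ → id ; unassigned = λ _ → id ; assigned = λ () }

    invariant-step : ∀ {δ c c′ v i P} → Step c v i c′ → ¬ v ∈L P →
      Invariant δ c P → Invariant (δ ++ i ∷ []) c′ (P ++ v ∷ [])
    invariant-step {δ} {c} {c′} {v} {i} {P} st v∉P inv =
      record { ⊆C̄ = λ j w∈ → ⊆C̄ j (shrink w∈) ; unassigned = unassigned′ ; assigned = assigned′ }
      where
      open Invariant inv
      confines : Confines c v i c′
      confines = step⇒confines {c} {v} {i} {c′} st
      shrink : ∀ {j w} → w ∈ lookup c′ j → w ∈ lookup c j
      shrink w∈ = proj₁ (to (confines _ _) w∈)
      keep : ∀ {j w} → w ≢ v → w ∈ lookup c j → w ∈ lookup c′ j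
      keep w≢v w∈ = from (confines _ _) (w∈ , inj₂ w≢v)
      unassigned′ : ∀ {j w} → ¬ w ∈L P ++ v ∷ [] → w ∈ C̄ j → w ∈ lookup c′ j
      unassigned′ w∉ w∈C̄ =
        keep (λ w≡v → w∉ (∈-++⁺ʳ P (here w≡v))) (unassigned (λ w∈P → w∉ (∈-++⁺ˡ w∈P)) w∈C̄)
      assigned′ : ∀ {w} → w ∈L P ++ v ∷ [] →
        ∃ λ i′ → i′ ∈L δ ++ i ∷ [] × w ∈ lookup c′ i′ × (∀ {j} → w ∈ lookup c′ j → j ≡ i′)
      assigned′ w∈ with ∈-++⁻ P w∈
      ... | inj₁ w∈P =
        let (i₀ , i₀∈δ , w∈i₀ , only-i₀) = assigned w∈P
        in i₀ , ∈-++⁺ˡ i₀∈δ , keep (λ { refl → v∉P w∈P }) w∈i₀ , λ w∈j → only-i₀ (shrink w∈j)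
      ... | inj₂ (here refl) =
        i , ∈-++⁺ʳ δ (here refl) , from (confines i v) (proj₁ st , inj₁ refl) ,
        λ v∈j → [ id , (λ v≢v → contradiction refl v≢v) ]′ (proj₂ (to (confines _ _) v∈j))

    invariant-path : ∀ {δ c vs cfg} P → PrunedPath δ c vs cfg → Invariant δ c P → ¬ T1 δ c →
      Unique (P ++ vs) → ∃ λ δ′ → Invariant δ′ cfg (P ++ vs) × ¬ T1 δ′ cfg
    invariant-path {δ} P done inv ¬t1 _ = δ , subst (Invariant δ _) (sym (++-identityʳ P)) inv , ¬t1
    invariant-path {vs = v ∷ vs} P (step i _ st ¬t1′ path) inv _ uniq
      with invariant-path (P ++ v ∷ []) path
             (invariant-step st (Unique[xs++y∷ys]⇒y∉xs P uniq) inv) ¬t1′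
             (subst Unique (sym (++-assoc P (v ∷ []) vs)) uniq)
    ... | δ′ , inv′ , ¬t1 = δ′ , subst (Invariant δ′ _) (++-assoc P (v ∷ []) vs) inv′ , ¬t1

    module FromInvariant {δ cfg} (inv : Invariant δ cfg S) (¬t1 : ¬ T1 δ cfg) where
      open Invariant inv

      C : Fin m → Subset n
      C = lookup cfg

      covered : ∀ v → ∃ λ i → v ∈ C i
      covered v with v ∈L? S
      ... | yes v∈S = let (i , _ , v∈i , _) = assigned v∈S in i , v∈i
      ... | no v∉S = let (k , ⁅v⁆⊆C̄k) = clique⊆C̄ (⁅⁆-clique v)
                     in k , unassigned v∉S (⁅v⁆⊆C̄k (x∈⁅x⁆ v))

      disjoint : ∀ {v i j} → v ∈ C i → v ∈ C j → i ≡ j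
      disjoint {v} v∈i v∈j with v ∈L? S
      ... | yes v∈S = let (_ , _ , _ , only) = assigned v∈S in trans (only v∈i) (sym (only v∈j))
      ... | no v∉S = d≤1⇒same-clique (∉S⇒d≤1 v∉S) (⊆C̄ _ v∈i) (⊆C̄ _ v∈j)

      -- Every vertex of a block outside δ was never assigned, so it lies in that block only.
      ∉δ⇒cliques≡⁅⁆ : ∀ {a u} → ¬ a ∈L δ → u ∈ C a → cliques u ≡ ⁅ a ⁆
      ∉δ⇒cliques≡⁅⁆ {a} {u} a∉δ u∈a with u ∈L? S
      ... | yes u∈S = let (i , i∈δ , _ , only) = assigned u∈S in
                      contradiction (subst (_∈L δ) (sym (only u∈a)) i∈δ) a∉δ
      ... | no u∉S = d≤1⇒cliques≡⁅⁆ (∉S⇒d≤1 u∉S) (⊆C̄ a u∈a)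

      unmergeable-∉δ-∈δ : ∀ {a b k u} → a ≢ b → ¬ a ∈L δ → b ∈L δ → u ∈ C a →
        C a ⊆ C̄ k → C b ⊆ C̄ k → Data.Empty.⊥
      unmergeable-∉δ-∈δ {a} {b} {u = u} a≢b a∉δ b∈δ u∈a a⊆k b⊆k =
        ¬t1 (inj₁ (b , b∈δ , ¬rgd-b , a , ⊆⇒InCliquesOf b⊆a , u , cliques-u))
        where
        cliques-u : cliques u ≡ ⁅ a ⁆
        cliques-u = ∉δ⇒cliques≡⁅⁆ a∉δ u∈a
        b⊆a : C b ⊆ C̄ a
        b⊆a w∈ = subst (λ l → _ ∈ C̄ l) (cliques≡⁅⁆⇒≡ cliques-u (a⊆k u∈a)) (b⊆k w∈)
        ¬rgd-b : ¬ Rgd b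
        ¬rgd-b (w , cliques-w) =
          a≢b (cliques≡⁅⁆⇒≡ cliques-w
                (b⊆a (unassigned (cliques≡⁅⁆⇒∉S cliques-w) (cliques≡⁅⁆⇒∈ cliques-w))))

      unmergeable : ∀ {a b k} → a ≢ b → Nonempty (C a) → Nonempty (C b) →
        C a ⊆ C̄ k → C b ⊆ C̄ k → Data.Empty.⊥
      unmergeable {a} {b} a≢b (u , u∈a) (w , w∈b) a⊆k b⊆k with a ∈L? δ | b ∈L? δ
      ... | yes a∈δ | yes b∈δ =
        ¬t1 (inj₂ (a , b , a∈δ , b∈δ , a≢b , _ , ⊆⇒InCliquesOf a⊆k , ⊆⇒InCliquesOf b⊆k))
      ... | no a∉δ | yes b∈δ = unmergeable-∉δ-∈δ a≢b a∉δ b∈δ u∈a a⊆k b⊆k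
      ... | yes a∈δ | no b∉δ = unmergeable-∉δ-∈δ (a≢b ∘ sym) b∉δ a∈δ w∈b b⊆k a⊆k
      ... | no a∉δ | no b∉δ =
        a≢b (trans (sym (cliques≡⁅⁆⇒≡ (∉δ⇒cliques≡⁅⁆ a∉δ u∈a) (a⊆k u∈a)))
                   (cliques≡⁅⁆⇒≡ (∉δ⇒cliques≡⁅⁆ b∉δ w∈b) (b⊆k w∈b)))

      block-clique : ∀ i → Nonempty (C i) → IsClique G (C i)
      block-clique i C≠∅ = clique-⊆ C≠∅ (⊆C̄ i) (C̄-clique i)

      πmcp : Πmcp cfg
      πmcp = (configuration , covered)
           , block-clique
           , (λ i j i≢j _ _ v v∈i v∈j → i≢j (disjoint v∈i v∈j))
           , (λ v → let (i , v∈i) = covered v in i , (v , v∈i) , v∈i)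
           , maximal
        where
        configuration : ∀ i → (C i ≡ ⊥ ⊎ IsClique G (C i)) × C i ⊆ C̄ i
        configuration i with nonempty? (C i)
        ... | yes C≠∅ = inj₂ (block-clique i C≠∅) , ⊆C̄ i
        ... | no C=∅ = inj₁ (Empty-unique C=∅) , ⊆C̄ i
        maximal : ∀ a b → a ≢ b → Nonempty (C a) → Nonempty (C b) → ¬ IsClique G (C a ∪ C b)
        maximal a b a≢b a≠∅ b≠∅ a∪b-clique =
          let (k , a∪b⊆k) = clique⊆C̄ a∪b-clique
          in unmergeable a≢b a≠∅ b≠∅ (λ w∈ → a∪b⊆k (p⊆p∪q (C b) w∈))
                                     (λ w∈ → a∪b⊆k (q⊆p∪q (C a) (C b) w∈))

    leaf⇒Πmcp : ∀ {cfg} → Leaf S cfg → Πmcp cfg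
    leaf⇒Πmcp (¬t1 , path) =
      let (δ , inv , ¬t1′) = invariant-path [] path invariant-root ¬t1 (proj₁ senum)
      in FromInvariant.πmcp inv ¬t1′

    module FromPartition {cfg} (pm : Πmcp cfg) where

      C : Fin m → Subset n
      C = lookup cfg

      ⊆C̄ : ∀ i → C i ⊆ C̄ i
      ⊆C̄ i = proj₂ (proj₁ (proj₁ pm) i)

      covered : ∀ v → ∃ λ i → v ∈ C i
      covered = proj₂ (proj₁ pm)

      disjoint : ∀ {v i j} → v ∈ C i → v ∈ C j → i ≡ j
      disjoint {v} {i} {j} v∈i v∈j with i ≟ j
      ... | yes i≡j = i≡j
      ... | no i≢j = ⊥-elim (proj₁ (proj₂ (proj₂ pm)) i j i≢j (v , v∈i) (v , v∈j) v v∈i v∈j)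

      unmergeable : ∀ {a b k} → a ≢ b → Nonempty (C a) → Nonempty (C b) →
        C a ⊆ C̄ k → C b ⊆ C̄ k → Data.Empty.⊥
      unmergeable a≢b a≠∅ b≠∅ a⊆k b⊆k =
        proj₂ (proj₂ (proj₂ (proj₂ pm))) _ _ a≢b a≠∅ b≠∅ (∪-clique a≠∅ a⊆k b⊆k)

      ∉S⇒∈C : ∀ {v i} → ¬ v ∈L S → v ∈ C̄ i → v ∈ C i
      ∉S⇒∈C {v} v∉S v∈C̄i =
        let (j , v∈j) = covered v
        in subst (λ k → v ∈ C k) (d≤1⇒same-clique (∉S⇒d≤1 v∉S) (⊆C̄ j v∈j) v∈C̄i) v∈j

      -- The node of the search tree above cfg at which the vertices of vs are still unassigned.
      reopen : List (Fin n) → Cfg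
      reopen [] = cfg
      reopen (v ∷ vs) = tabulate λ j → lookup (reopen vs) j ∪ (C̄ j ∩ ⁅ v ⁆)

      ∈reopen-∷⁺ : ∀ v vs {j w} → w ∈ lookup (reopen vs) j ⊎ (w ∈ C̄ j × w ∈ ⁅ v ⁆) →
        w ∈ lookup (reopen (v ∷ vs)) j
      ∈reopen-∷⁺ v vs {j} {w} w∈ =
        subst (w ∈_) (sym (lookup∘tabulate _ j)) (x∈p∪q⁺ (Sum.map₂ x∈p∩q⁺ w∈))

      ∈reopen-∷⁻ : ∀ v vs {j w} → w ∈ lookup (reopen (v ∷ vs)) j →
        w ∈ lookup (reopen vs) j ⊎ (w ∈ C̄ j × w ∈ ⁅ v ⁆)
      ∈reopen-∷⁻ v vs {j} {w} w∈ =
        Sum.map₂ (x∈p∩q⁻ (C̄ j) ⁅ v ⁆) (x∈p∪q⁻ _ _ (subst (w ∈_) (lookup∘tabulate _ j) w∈))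

      C⊆reopen : ∀ vs {j} → C j ⊆ lookup (reopen vs) j
      C⊆reopen [] w∈ = w∈
      C⊆reopen (v ∷ vs) w∈ = ∈reopen-∷⁺ v vs (inj₁ (C⊆reopen vs w∈))

      ∈reopen⁺ : ∀ vs {j w} → w ∈L vs → w ∈ C̄ j → w ∈ lookup (reopen vs) j
      ∈reopen⁺ (v ∷ vs) (here refl) w∈C̄ = ∈reopen-∷⁺ v vs (inj₂ (w∈C̄ , x∈⁅x⁆ v))
      ∈reopen⁺ (v ∷ vs) (there w∈vs) w∈C̄ = ∈reopen-∷⁺ v vs (inj₁ (∈reopen⁺ vs w∈vs w∈C̄))

      ∈reopen⁻ : ∀ vs {j w} → w ∈ lookup (reopen vs) j → w ∈ C j ⊎ (w ∈L vs × w ∈ C̄ j)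
      ∈reopen⁻ [] w∈ = inj₁ w∈
      ∈reopen⁻ (v ∷ vs) w∈ with ∈reopen-∷⁻ v vs w∈
      ... | inj₁ w∈′ = Sum.map₂ (λ (w∈vs , w∈C̄) → there w∈vs , w∈C̄) (∈reopen⁻ vs w∈′)
      ... | inj₂ (w∈C̄ , w∈⁅v⁆) = inj₂ (here (x∈⁅y⁆⇒x≡y v w∈⁅v⁆) , w∈C̄)

      reopen-S : reopen S ≡ Cbar
      reopen-S = lookup-⊆-antisym reopen⊆C̄ C̄⊆reopen
        where
        reopen⊆C̄ : ∀ j → lookup (reopen S) j ⊆ C̄ j
        reopen⊆C̄ j w∈ = [ ⊆C̄ j , proj₂ ] (∈reopen⁻ S w∈)
        C̄⊆reopen : ∀ j → C̄ j ⊆ lookup (reopen S) j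
        C̄⊆reopen j {w} w∈ with w ∈L? S
        ... | yes w∈S = ∈reopen⁺ S w∈S w∈
        ... | no w∉S = C⊆reopen S (∉S⇒∈C w∉S w∈)

      reopen-step : ∀ {v vs i} → ¬ v ∈L vs → v ∈ C i → Step (reopen (v ∷ vs)) v i (reopen vs)
      reopen-step {v} {vs} {i} v∉vs v∈i =
        confines⇒step {reopen (v ∷ vs)} {v} {i} {reopen vs} (C⊆reopen (v ∷ vs) v∈i)
                      (λ _ _ → mk⇔ forward backward)
        where
        forward : ∀ {j w} → w ∈ lookup (reopen vs) j →
          w ∈ lookup (reopen (v ∷ vs)) j × (j ≡ i ⊎ w ≢ v)
        forward {j} {w} w∈ with w ≟ v
        ... | no w≢v = ∈reopen-∷⁺ v vs (inj₁ w∈) , inj₂ w≢v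
        ... | yes refl = ∈reopen-∷⁺ v vs (inj₁ w∈) ,
                         inj₁ ([ (λ v∈j → disjoint v∈j v∈i) , (λ (v∈vs , _) → contradiction v∈vs v∉vs) ]′
                                 (∈reopen⁻ vs w∈))
        backward : ∀ {j w} → w ∈ lookup (reopen (v ∷ vs)) j × (j ≡ i ⊎ w ≢ v) →
          w ∈ lookup (reopen vs) j
        backward (w∈ , j≡i⊎w≢v) with ∈reopen-∷⁻ v vs w∈
        ... | inj₁ w∈′ = w∈′
        ... | inj₂ (_ , w∈⁅v⁆) with x∈⁅y⁆⇒x≡y v w∈⁅v⁆ | j≡i⊎w≢v
        ...   | refl | inj₁ refl = C⊆reopen vs v∈i
        ...   | refl | inj₂ v≢v = contradiction refl v≢v

      reopen-¬T1 : ∀ {δ} vs → (∀ {a} → a ∈L δ → Nonempty (C a)) → ¬ T1 δ (reopen vs)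
      reopen-¬T1 vs C≠∅ (inj₁ (a , a∈δ , ¬rgd-a , k , inc , u , cliques-u)) =
        unmergeable a≢k (C≠∅ a∈δ) (u , u∈k) (λ w∈ → InCliquesOf⇒⊆ inc (C⊆reopen vs w∈)) (⊆C̄ k)
        where
        a≢k : a ≢ k
        a≢k refl = ¬rgd-a (u , cliques-u)
        u∈k : u ∈ C k
        u∈k = let (j , u∈j) = covered u
              in subst (λ l → u ∈ C l) (cliques≡⁅⁆⇒≡ cliques-u (⊆C̄ j u∈j)) u∈j
      reopen-¬T1 vs C≠∅ (inj₂ (a , b , a∈δ , b∈δ , a≢b , k , inc-a , inc-b)) =
        unmergeable a≢b (C≠∅ a∈δ) (C≠∅ b∈δ)
          (λ w∈ → InCliquesOf⇒⊆ inc-a (C⊆reopen vs w∈)) (λ w∈ → InCliquesOf⇒⊆ inc-b (C⊆reopen vs w∈))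

      pruned-path : ∀ {δ} vs → Unique vs → (∀ {a} → a ∈L δ → Nonempty (C a)) →
        PrunedPath δ (reopen vs) vs cfg
      pruned-path [] _ _ = done
      pruned-path {δ} (v ∷ vs) uniq@(_ ∷ uniq′) C≠∅ with covered v
      ... | i , v∈i =
        step i (∈cliques⁺ (⊆C̄ i v∈i)) (reopen-step (Unique[x∷xs]⇒x∉xs uniq) v∈i)
             (reopen-¬T1 vs C≠∅′) (pruned-path vs uniq′ C≠∅′)
        where
        C≠∅′ : ∀ {a} → a ∈L δ ++ i ∷ [] → Nonempty (C a)
        C≠∅′ a∈ with ∈-++⁻ δ a∈
        ... | inj₁ a∈δ = C≠∅ a∈δ
        ... | inj₂ (here refl) = v , v∈i

      leaf : Leaf S cfg
      leaf = ¬T1-[] root , subst (λ c → PrunedPath [] c S cfg) reopen-S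
                                 (pruned-path S (proj₁ senum) (λ ()))

    Πmcp⇒leaf : ∀ {cfg} → Πmcp cfg → Leaf S cfg
    Πmcp⇒leaf = FromPartition.leaf

corollary2 : ∀ {n} (G : Graph n) (m : ℕ) (Cbar : Vec (Subset n) m) →
    IsMaxCliqueEnum G Cbar →
    (S : List (Fin n)) → Setup.IsSEnum G Cbar S →
    (cfg : Vec (Subset n) m) →
    Setup.Leaf G Cbar S cfg ⇔ Setup.Πmcp G Cbar cfg
corollary2 G m Cbar enum S senum cfg = mk⇔ (leaf⇒Πmcp senum) (Πmcp⇒leaf senum)
  where open Enumeration G Cbar enum
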